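{- If $f:\{0,1\}^n\to\{0,1\}$ is either symmetric or monotone, then $$\mathsf{ms}(f)=\mathsf{mbs}(f)=\mathsf{fmbs}(f)=\mathsf{MCC}(f).$$
   Context: $f$ is symmetric if $f(x)$ depends only on the Hamming weight of $x$; $f$ is monotone if it is non-decreasing or non-increasing with respect to the coordinatewise order on $\{0,1\}^n$. For $x\in\{0,1\}^n$ let $\mathrm{supp}(x)=\{i:x_i=1\}$, $|x|=|\mathrm{supp}(x)|$, and let $f_x$ be the restriction of $f$ to $\{y: y_i=1\ \forall i\in\mathrm{supp}(x)\}$, viewed as a function of the remaining $n-|x|$ coordinates. For a Boolean function $h$ and input $z$: $\mathsf{s}(h,z)$ is the number of coordinates $i$ with $h(z^{\oplus i})\ne h(z)$; $\mathsf{bs}(h,z)$ is the maximum number of pairwise disjoint sets $B$ with $h(z^B)\neq h(z)$ ($z^B$ = $z$ with bits in $B$ flipped); $\mathsf{fbs}(h,z)$ is the optimum of: maximize $\sum_{B\in W}b_B$ s.t. $\sum_{B\in W: i\in B}b_B\le 1$ for all $i$, $b_B\in[0,1]$, where $W$ is the set of sensitive blocks at $z$; $\mathsf{C}(h,z)$ is the minimum size of a set $C$ of coordinates such that every $y$ agreeing with $z$ on $C$ has $h(y)=h(z)$. Monotone measures: $\mathsf{ms}(f,x)=\mathsf{s}(f_x,0^{n-|x|})$, $\mathsf{mbs}(f,x)=\mathsf{bs}(f_x,0^{n-|x|})$, $\mathsf{fmbs}(f,x)=\mathsf{fbs}(f_x,0^{n-|x|})$, $\mathsf{MCC}(f,x)=\mathsf{C}(f_x,0^{n-|x|})$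 (hitting set complexity); each measure of $f$ is the maximum over $x\in\{0,1\}^n$.
   Formalization: The weights $b_B$ in the linear program defining fractional block sensitivity, and hence $\mathsf{fmbs}(f)$, are taken over the rationals. -}

module Defs where

open import Data.Bool using (Bool; true; false; _∧_; _∨_; _xor_; if_then_else_; not)
open import Data.Nat using (ℕ; zero; suc; _+_) renaming (_≤_ to _≤ℕ_)
open import Data.Fin using (Fin; zero; suc; _≟_)
open import Data.List using (List; []; _∷_; _++_; map)
open import Data.Product using (Σ; _×_; _,_; ∃)
open import Data.Sum using (_⊎_)
open import Data.Integer using (+_)
open import Data.Rational using (ℚ; 0ℚ; 1ℚ; _/_) renaming (_+_ to _+ℚ_; _≤_ to _≤ℚ_)
open import Relation.Nullary using (¬_)
open import Relation.Nullary.Decidable using (⌊_⌋)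
open import Relation.Binary.PropositionalEquality using (_≡_; _≢_)

-- Inputs x ∈ {0,1}^n are functions Fin n → Bool; Boolean functions are
-- maps (Fin n → Bool) → Bool.  Subsets of [n] are also Fin n → Bool.

Input : ℕ → Set
Input n = Fin n → Bool

BoolFun : ℕ → Set
BoolFun n = Input n → Bool

count : ∀ {n} → (Fin n → Bool) → ℕ
count {zero}  x = 0
count {suc n} x = (if x zero then 1 else 0) + count (λ i → x (suc i))

anyF : ∀ {n} → (Fin n → Bool) → Bool
anyF {zero}  p = false
anyF {suc n} p = p zero ∨ anyF (λ i → p (suc i))

zeroVec : ∀ {n} → Input n
zeroVec _ = false

flip1 : ∀ {n} → Input n → Fin n → Input n
flip1 z i j = if ⌊ i ≟ j ⌋ then not (z j) else z j

flipSet : ∀ {n} → Input n → (Fin n → Bool) → Input n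
flipSet z B j = z j xor B j

allSubsets : (n : ℕ) → List (Fin n → Bool)
allSubsets zero    = (λ ()) ∷ []
allSubsets (suc n) =
  map (λ B → λ { zero → false ; (suc i) → B i }) (allSubsets n) ++
  map (λ B → λ { zero → true  ; (suc i) → B i }) (allSubsets n)

Symmetric : ∀ {n} → BoolFun n → Set
Symmetric {n} f = ∀ (x y : Input n) → count x ≡ count y → f x ≡ f y

_≼_ : ∀ {n} → Input n → Input n → Set
x ≼ y = ∀ i → x i ≡ true → y i ≡ true

NonDecreasing : ∀ {n} → BoolFun n → Set
NonDecreasing {n} f = ∀ (x y : Input n) → x ≼ y → f x ≡ true → f y ≡ true

NonIncreasing : ∀ {n} → BoolFun n → Set
NonIncreasing {n} f = ∀ (x y : Input n) → x ≼ y → f y ≡ true → f x ≡ true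

Monotone : ∀ {n} → BoolFun n → Set
Monotone f = NonDecreasing f ⊎ NonIncreasing f

-- Restriction f_x : the free coordinates of x are its zero positions,
-- listed in increasing order via zeroPos x : Fin (numZeros x) → Fin n.

nz : Bool → ℕ → ℕ
nz true  k = k
nz false k = suc k

zp : ∀ {n} (b : Bool) (k : ℕ) → (Fin k → Fin n) → Fin (nz b k) → Fin (suc n)
zp true  k g j       = suc (g j)
zp false k g zero    = zero
zp false k g (suc j) = suc (g j)

numZeros : ∀ {n} → Input n → ℕ
numZeros {zero}  x = 0
numZeros {suc n} x = nz (x zero) (numZeros (λ i → x (suc i)))

zeroPos : ∀ {n} (x : Input n) → Fin (numZeros x) → Fin n
zeroPos {zero}  x ()
zeroPos {suc n} x = zp (x zero) _ (zeroPos (λ i → x (suc i)))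

-- the point of the subcube {y : y_i = 1 ∀ i ∈ supp x} with free part y
embed : ∀ {n} (x : Input n) → Input (numZeros x) → Input n
embed x y i = x i ∨ anyF (λ j → y j ∧ ⌊ zeroPos x j ≟ i ⌋)

restrict : ∀ {n} → BoolFun n → (x : Input n) → BoolFun (numZeros x)
restrict f x y = f (embed x y)

Sensitive : ∀ {m} → BoolFun m → Input m → (Fin m → Bool) → Set
Sensitive h z B = h (flipSet z B) ≢ h z

sens : ∀ {m} → BoolFun m → Input m → ℕ
sens h z = count (λ i → h (flip1 z i) xor h z)

DisjointSensitiveBlocks : ∀ {m} → BoolFun m → Input m → (k : ℕ) → Set
DisjointSensitiveBlocks {m} h z k =
  Σ (Fin k → (Fin m → Bool)) λ B →
    (∀ a → Sensitive h z (B a)) ×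
    (∀ a b → a ≢ b → ∀ i → B a i ≡ true → B b i ≡ false)

IsBs : ∀ {m} → BoolFun m → Input m → ℕ → Set
IsBs h z k = DisjointSensitiveBlocks h z k ×
             (∀ j → DisjointSensitiveBlocks h z j → j ≤ℕ k)

-- fractional block sensitivity (LP over the sensitive blocks W)
-- weights b : subsets → ℚ ; only b_B for B ∈ W enter the LP
-- sum of b_B over sensitive blocks B in the list satisfying predicate p
sumSens : ∀ {m} → BoolFun m → Input m → ((Fin m → Bool) → Bool) →
          ((Fin m → Bool) → ℚ) → List (Fin m → Bool) → ℚ
sumSens h z p b [] = 0ℚ
sumSens h z p b (B ∷ Bs) =
  (if (h (flipSet z B) xor h z) ∧ p B then b B else 0ℚ) +ℚ sumSens h z p b Bs

FeasibleFbs : ∀ {m} → BoolFun m → Input m → ((Fin m → Bool) → ℚ) → Set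
FeasibleFbs {m} h z b =
  (∀ B → Sensitive h z B → (0ℚ ≤ℚ b B) × (b B ≤ℚ 1ℚ)) ×
  (∀ (i : Fin m) → sumSens h z (λ B → B i) b (allSubsets m) ≤ℚ 1ℚ)

fbsValue : ∀ {m} → BoolFun m → Input m → ((Fin m → Bool) → ℚ) → ℚ
fbsValue {m} h z b = sumSens h z (λ _ → true) b (allSubsets m)

IsFbs : ∀ {m} → BoolFun m → Input m → ℚ → Set
IsFbs h z q =
  (∃ λ b → FeasibleFbs h z b × fbsValue h z b ≡ q) ×
  (∀ b → FeasibleFbs h z b → fbsValue h z b ≤ℚ q)

IsCertificate : ∀ {m} → BoolFun m → Input m → (Fin m → Bool) → Set
IsCertificate {m} h z C = ∀ (y : Input m) → (∀ i → C i ≡ true → y i ≡ z i) → h y ≡ h z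

IsC : ∀ {m} → BoolFun m → Input m → ℕ → Set
IsC h z k = (∃ λ C → IsCertificate h z C × count C ≡ k) ×
            (∀ C → IsCertificate h z C → k ≤ℕ count C)

IsMaxℕ : ∀ {n} → (Input n → ℕ → Set) → ℕ → Set
IsMaxℕ R k = (∃ λ x → R x k) × (∀ x j → R x j → j ≤ℕ k)

IsMaxℚ : ∀ {n} → (Input n → ℚ → Set) → ℚ → Set
IsMaxℚ R q = (∃ λ x → R x q) × (∀ x r → R x r → r ≤ℚ q)

IsMs : ∀ {n} → BoolFun n → ℕ → Set
IsMs f = IsMaxℕ (λ x j → sens (restrict f x) zeroVec ≡ j)

IsMbs : ∀ {n} → BoolFun n → ℕ → Set
IsMbs f = IsMaxℕ (λ x j → IsBs (restrict f x) zeroVec j)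

IsFmbs : ∀ {n} → BoolFun n → ℚ → Set
IsFmbs f = IsMaxℚ (λ x q → IsFbs (restrict f x) zeroVec q)

IsMCC : ∀ {n} → BoolFun n → ℕ → Set
IsMCC f = IsMaxℕ (λ x j → IsC (restrict f x) zeroVec j)

toℚ : ℕ → ℚ
toℚ k = (+ k) / 1

-- Call y critical for f when flipping any single zero of y changes f, i.e. when the
-- restriction f_y is sensitive to every free coordinate at 0. Then the singletons are
-- disjoint sensitive blocks and the set of all free coordinates is a certificate, so
-- ms, mbs, fmbs and MCC of f at y all equal the number of zeros of y.
-- For symmetric or monotone f, greedily flipping zeros of x that leave f unchanged
-- reaches a critical y with f constant on the interval [x, y], and the zeros of y then
-- certify f_x at 0. Since s, bs and fbs never exceed the size of a certificate, every
-- measure at every x is at most the largest number of zeros of a critical point,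
-- and all four measures attain this bound there.

module Submission where

open import Defs
open import Data.Nat using (ℕ)
open import Data.Sum using (_⊎_)
open import Data.Product using (∃; _×_)

import Data.Bool.Properties as BoolP
import Data.Fin.Properties as FinP
import Data.Integer as ℤ
import Data.Integer.Properties as ℤP
import Data.List.Relation.Unary.All as All
import Data.Nat.Coprimality as Coprimality
import Data.Nat.Properties as ℕP
import Data.Rational.Properties as ℚP
open import Algebra.Properties.CommutativeMonoid.Sum ℚP.+-0-commutativeMonoid
  using (sum-cong-≗; ∑-distrib-+) renaming (sum to sumℚ)
open import Data.Bool as Bool using (Bool; true; false; _∧_; _∨_; _xor_; if_then_else_; not)
open import Data.Empty using (⊥-elim)
open import Data.Fin using (Fin; zero; suc; _≟_)
open import Data.List using (List; []; _∷_; _++_; map; filter)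
open import Data.List.Extrema.Nat using (argmax; argmax-all; f[xs]≤f[argmax])
open import Data.List.Membership.Propositional using (_∈_)
open import Data.List.Membership.Propositional.Properties using (∈-map⁺; ∈-++⁺ˡ; ∈-++⁺ʳ; ∈-filter⁺)
open import Data.List.Relation.Unary.All.Properties using (all-filter)
open import Data.List.Relation.Unary.Any using (here)
open import Data.Nat as ℕ using (zero; suc; _+_; _∸_; _≤_; z≤n; s≤s; _≡ᵇ_)
open import Data.Product using (_,_; proj₁; proj₂)
open import Data.Rational as ℚ using (ℚ; mkℚ; 0ℚ; 1ℚ; _/_)
open import Data.Sum using (inj₁; inj₂)
open import Function using (_∘_; mk⇔)
open import Relation.Binary.PropositionalEquality
open import Relation.Nullary using (Dec; yes; no; ¬?)
open import Relation.Nullary.Decidable using (⌊_⌋; _×-dec_; _→-dec_)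

≟-false : ∀ {n} {i j : Fin n} → i ≢ j → ⌊ i ≟ j ⌋ ≡ false
≟-false {i = i} {j} i≢j with i ≟ j
... | yes i≡j = ⊥-elim (i≢j i≡j)
... | no _ = refl

⌊suc≟suc⌋ : ∀ {n} (i j : Fin n) → ⌊ suc i ≟ suc j ⌋ ≡ ⌊ i ≟ j ⌋
⌊suc≟suc⌋ i j with i ≟ j
... | yes _ = refl
... | no _ = refl

true≢false : true ≢ false
true≢false ()

xor≡true⇒≢ : ∀ {a b} → a xor b ≡ true → a ≢ b
xor≡true⇒≢ {true} {true} () _
xor≡true⇒≢ {false} {false} () _
xor≡true⇒≢ {true} {false} _ ()
xor≡true⇒≢ {false} {true} _ ()

≢⇒xor≡true : ∀ {a b} → a ≢ b → a xor b ≡ true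
≢⇒xor≡true {true} {true} a≢b = ⊥-elim (a≢b refl)
≢⇒xor≡true {true} {false} _ = refl
≢⇒xor≡true {false} {true} _ = refl
≢⇒xor≡true {false} {false} a≢b = ⊥-elim (a≢b refl)

∨≡true⇒ : ∀ {a b} → a ∨ b ≡ true → a ≡ true ⊎ b ≡ true
∨≡true⇒ {true} _ = inj₁ refl
∨≡true⇒ {false} b≡true = inj₂ b≡true

∧≡true⇒ : ∀ {a b} → a ∧ b ≡ true → a ≡ true × b ≡ true
∧≡true⇒ {true} b≡true = refl , b≡true

true-⇔⇒≡ : ∀ {a b} → (a ≡ true → b ≡ true) → (b ≡ true → a ≡ true) → a ≡ b
true-⇔⇒≡ a⇒b b⇒a = BoolP.⇔→≡ (mk⇔ a⇒b b⇒a)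

flip1-other : ∀ {n} (z : Input n) {i j} → i ≢ j → flip1 z i j ≡ z j
flip1-other z i≢j rewrite ≟-false i≢j = refl

flip1-cong : ∀ {n} {x y : Input n} → x ≗ y → ∀ i → flip1 x i ≗ flip1 y i
flip1-cong x≗y i j rewrite x≗y j = refl

indicator : Bool → ℕ
indicator b = if b then 1 else 0

count-cong : ∀ {n} {x y : Fin n → Bool} → x ≗ y → count x ≡ count y
count-cong {zero} _ = refl
count-cong {suc n} x≗y = cong₂ _+_ (cong indicator (x≗y zero)) (count-cong (x≗y ∘ suc))

count-mono : ∀ {n} {x y : Fin n → Bool} → (∀ i → x i ≡ true → y i ≡ true) → count x ≤ count y
count-mono {zero} _ = z≤n
count-mono {suc n} {x} {y} x⇒y with x zero in x₀ | y zero in y₀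
... | true  | true  = s≤s (count-mono (x⇒y ∘ suc))
... | true  | false = ⊥-elim (true≢false (trans (sym (x⇒y zero x₀)) y₀))
... | false | true  = ℕP.m≤n⇒m≤1+n (count-mono (x⇒y ∘ suc))
... | false | false = count-mono (x⇒y ∘ suc)

count-full : ∀ n → count {n} (λ _ → true) ≡ n
count-full zero = refl
count-full (suc n) = cong suc (count-full n)

count≤n : ∀ {n} (x : Fin n → Bool) → count x ≤ n
count≤n {n} x = subst (count x ≤_) (count-full n) (count-mono {x = x} {y = λ _ → true} (λ _ _ → refl))

count≡n⇒full : ∀ {n} (x : Fin n → Bool) → count x ≡ n → ∀ i → x i ≡ true
count≡n⇒full {suc n} x ∣x∣≡n i with x zero in x₀
count≡n⇒full {suc n} x ∣x∣≡n zero    | true = x₀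
count≡n⇒full {suc n} x ∣x∣≡n (suc i) | true = count≡n⇒full (x ∘ suc) (ℕP.suc-injective ∣x∣≡n) i
... | false = ⊥-elim (ℕP.<-irrefl refl (subst (_≤ n) ∣x∣≡n (count≤n (x ∘ suc))))

count≡0⇒empty : ∀ {n} (x : Fin n → Bool) → count x ≡ 0 → ∀ i → x i ≡ false
count≡0⇒empty {suc n} x ∣x∣≡0 i with x zero in x₀
count≡0⇒empty {suc n} x ()    i       | true
count≡0⇒empty {suc n} x ∣x∣≡0 zero    | false = x₀
count≡0⇒empty {suc n} x ∣x∣≡0 (suc i) | false = count≡0⇒empty (x ∘ suc) ∣x∣≡0 i

count-flip1 : ∀ {n} (y : Input n) i → y i ≡ false → count (flip1 y i) ≡ suc (count y)
count-flip1 {suc n} y zero y₀ rewrite y₀ = cong suc (count-cong {y = y ∘ suc} (λ _ → refl))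
count-flip1 {suc n} y (suc i) yᵢ = begin
  indicator (y zero) + count (flip1 y (suc i) ∘ suc)
    ≡⟨ cong (indicator (y zero) +_) (count-cong {y = flip1 (y ∘ suc) i} shift) ⟩
  indicator (y zero) + count (flip1 (y ∘ suc) i)
    ≡⟨ cong (indicator (y zero) +_) (count-flip1 (y ∘ suc) i yᵢ) ⟩
  indicator (y zero) + suc (count (y ∘ suc))
    ≡⟨ ℕP.+-suc (indicator (y zero)) _ ⟩
  suc (count y) ∎
  where
  open ≡-Reasoning
  shift : flip1 y (suc i) ∘ suc ≗ flip1 (y ∘ suc) i
  shift j = cong (λ b → if b then not (y (suc j)) else y (suc j)) (⌊suc≟suc⌋ i j)

count-remove : ∀ {m} (C : Fin m → Bool) i → C i ≡ true →
               count C ≡ suc (count (λ j → C j ∧ not ⌊ i ≟ j ⌋))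
count-remove {suc m} C zero C₀ rewrite C₀ =
  cong suc (count-cong (λ j → sym (BoolP.∧-identityʳ (C (suc j)))))
count-remove {suc m} C (suc i) Cᵢ = begin
  indicator (C zero) + count (C ∘ suc)
    ≡⟨ cong (indicator (C zero) +_) (count-remove (C ∘ suc) i Cᵢ) ⟩
  indicator (C zero) + suc (count (λ j → C (suc j) ∧ not ⌊ i ≟ j ⌋))
    ≡⟨ ℕP.+-suc (indicator (C zero)) _ ⟩
  suc (indicator (C zero) + count (λ j → C (suc j) ∧ not ⌊ i ≟ j ⌋))
    ≡⟨ cong suc (cong₂ _+_ (cong indicator (sym (BoolP.∧-identityʳ (C zero))))
                           (count-cong (λ j → cong (λ b → C (suc j) ∧ not b) (sym (⌊suc≟suc⌋ i j))))) ⟩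
  suc (count (λ j → C j ∧ not ⌊ suc i ≟ j ⌋)) ∎
  where open ≡-Reasoning

injection⇒≤count : ∀ {m} k (C : Fin m → Bool) (ι : Fin k → Fin m) →
                   (∀ a → C (ι a) ≡ true) → (∀ a b → ι a ≡ ι b → a ≡ b) → k ≤ count C
injection⇒≤count zero C ι _ _ = z≤n
injection⇒≤count (suc k) C ι ι∈C ι-inj =
  subst (suc k ≤_) (sym (count-remove C (ι zero) (ι∈C zero)))
    (s≤s (injection⇒≤count k _ (ι ∘ suc) ι∈C′ (λ a b eq → FinP.suc-injective (ι-inj _ _ eq))))
  where
  ι∈C′ : ∀ a → C (ι (suc a)) ∧ not ⌊ ι zero ≟ ι (suc a) ⌋ ≡ true
  ι∈C′ a rewrite ≟-false {i = ι zero} {ι (suc a)} (λ eq → FinP.0≢1+n (ι-inj _ _ eq))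
               | BoolP.∧-identityʳ (C (ι (suc a))) = ι∈C (suc a)

≼-refl : ∀ {n} {x : Input n} → x ≼ x
≼-refl _ xᵢ = xᵢ

≗⇒≼ : ∀ {n} {x y : Input n} → x ≗ y → x ≼ y
≗⇒≼ x≗y i xᵢ = trans (sym (x≗y i)) xᵢ

≼-trans : ∀ {n} {x y z : Input n} → x ≼ y → y ≼ z → x ≼ z
≼-trans x≼y y≼z i xᵢ = y≼z i (x≼y i xᵢ)

≼-flip1 : ∀ {n} (y : Input n) i → y i ≡ false → y ≼ flip1 y i
≼-flip1 y i yᵢ j yⱼ with i ≟ j
... | yes refl = ⊥-elim (true≢false (trans (sym yⱼ) yᵢ))
... | no _     = yⱼ

anyF-false : ∀ {n} → anyF {n} (λ _ → false) ≡ false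
anyF-false {zero} = refl
anyF-false {suc n} = anyF-false {n}

anyF-cong : ∀ {n} {p q : Fin n → Bool} → p ≗ q → anyF p ≡ anyF q
anyF-cong {zero} _ = refl
anyF-cong {suc n} p≗q = cong₂ _∨_ (p≗q zero) (anyF-cong (p≗q ∘ suc))

anyF≡true⇒∃ : ∀ {n} (p : Fin n → Bool) → anyF p ≡ true → ∃ λ j → p j ≡ true
anyF≡true⇒∃ {suc n} p any-p with ∨≡true⇒ {p zero} any-p
... | inj₁ p₀ = zero , p₀
... | inj₂ any-p′ with anyF≡true⇒∃ (p ∘ suc) any-p′
... | j , pⱼ = suc j , pⱼ

anyF-flip1 : ∀ {n} (j : Fin n) (p : Fin n → Bool) → anyF (λ k → flip1 zeroVec j k ∧ p k) ≡ p j
anyF-flip1 {suc n} zero p = trans (cong (p zero ∨_) (anyF-false {n})) (BoolP.∨-identityʳ (p zero))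
anyF-flip1 {suc n} (suc j) p =
  trans (anyF-cong (λ k → cong (λ b → (if b then true else false) ∧ p (suc k)) (⌊suc≟suc⌋ j k)))
        (anyF-flip1 j (p ∘ suc))

zeroPos-isZero : ∀ {n} (x : Input n) j → x (zeroPos x j) ≡ false
zeroPos-isZero {suc n} x j with x zero in x₀
zeroPos-isZero {suc n} x j       | true  = zeroPos-isZero (x ∘ suc) j
zeroPos-isZero {suc n} x zero    | false = x₀
zeroPos-isZero {suc n} x (suc j) | false = zeroPos-isZero (x ∘ suc) j

embed-zeroVec : ∀ {n} (x : Input n) → embed x zeroVec ≗ x
embed-zeroVec x i = trans (cong (x i ∨_) (anyF-false {numZeros x})) (BoolP.∨-identityʳ (x i))

embed-flip1 : ∀ {n} (x : Input n) j → embed x (flip1 zeroVec j) ≗ flip1 x (zeroPos x j)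
embed-flip1 x j i rewrite anyF-flip1 j (λ k → ⌊ zeroPos x k ≟ i ⌋) with zeroPos x j ≟ i
... | yes refl rewrite zeroPos-isZero x j = refl
... | no _ = BoolP.∨-identityʳ (x i)

embed-cong : ∀ {n} (x : Input n) {y y′} → y ≗ y′ → embed x y ≗ embed x y′
embed-cong x y≗y′ i = cong (x i ∨_) (anyF-cong (λ j → cong (_∧ _) (y≗y′ j)))

≼-embed : ∀ {n} (x : Input n) y → x ≼ embed x y
≼-embed x y i xᵢ rewrite xᵢ = refl

embed-≼ : ∀ {n} (x y : Input n) z → x ≼ y → (∀ j → z j ≡ true → y (zeroPos x j) ≡ true) →
          embed x z ≼ y
embed-≼ x y z x≼y z≼y i eᵢ with ∨≡true⇒ {x i} eᵢ
... | inj₁ xᵢ = x≼y i xᵢ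
... | inj₂ hit with anyF≡true⇒∃ _ hit
... | j , zⱼ∧j↦i with ∧≡true⇒ {z j} zⱼ∧j↦i | zeroPos x j ≟ i
... | zⱼ , _    | yes refl = z≼y j zⱼ
... | _  , j↦i | no j≢i   = ⊥-elim (true≢false (trans (sym j↦i) (≟-false j≢i)))

numZeros-cong : ∀ {n} {x y : Input n} → x ≗ y → numZeros x ≡ numZeros y
numZeros-cong {zero} _ = refl
numZeros-cong {suc n} x≗y = cong₂ nz (x≗y zero) (numZeros-cong (x≗y ∘ suc))

count-zeros-above : ∀ {n} (x y : Input n) → x ≼ y →
                    count (λ j → not (y (zeroPos x j))) ≡ numZeros y
count-zeros-above {zero} _ _ _ = refl
count-zeros-above {suc n} x y x≼y with x zero in x₀
... | true rewrite x≼y zero x₀ = count-zeros-above (x ∘ suc) (y ∘ suc) (x≼y ∘ suc)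
... | false with y zero
... | true  = count-zeros-above (x ∘ suc) (y ∘ suc) (x≼y ∘ suc)
... | false = cong suc (count-zeros-above (x ∘ suc) (y ∘ suc) (x≼y ∘ suc))

toℚ-+ : ∀ a b → toℚ (a + b) ≡ toℚ a ℚ.+ toℚ b
toℚ-+ a b = begin
  toℚ (a + b)                                        ≡⟨ cong (_/ 1) (ℤP.pos-+ a b) ⟩
  ((ℤ.+ a) ℤ.+ (ℤ.+ b)) / 1
    ≡⟨ cong (_/ 1) (sym (cong₂ ℤ._+_ (ℤP.*-identityʳ (ℤ.+ a)) (ℤP.*-identityʳ (ℤ.+ b)))) ⟩
  ((ℤ.+ a) ℤ.* (ℤ.+ 1) ℤ.+ (ℤ.+ b) ℤ.* (ℤ.+ 1)) / 1  ≡⟨ sym (cong₂ ℚ._+_ (asMkℚ a) (asMkℚ b)) ⟩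
  toℚ a ℚ.+ toℚ b                                    ∎
  where
  open ≡-Reasoning
  -- Written with mkℚ, the sum of two integers over 1 computes to the third line.
  asMkℚ : ∀ k → toℚ k ≡ mkℚ (ℤ.+ k) 0 (Coprimality.sym (Coprimality.1-coprimeTo k))
  asMkℚ k = ℚP.normalize-coprime (Coprimality.sym (Coprimality.1-coprimeTo k))

0≤toℚ : ∀ k → 0ℚ ℚ.≤ toℚ k
0≤toℚ k = ℚP.nonNegative⁻¹ (toℚ k) {{ℚP.normalize-nonNeg k 1}}

toℚ-mono : ∀ {a b} → a ≤ b → toℚ a ℚ.≤ toℚ b
toℚ-mono {a} {b} a≤b = begin
  toℚ a                     ≡⟨ sym (ℚP.+-identityʳ (toℚ a)) ⟩
  toℚ a ℚ.+ 0ℚ              ≤⟨ ℚP.+-monoʳ-≤ (toℚ a) (0≤toℚ (b ∸ a)) ⟩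
  toℚ a ℚ.+ toℚ (b ∸ a)     ≡⟨ sym (toℚ-+ a (b ∸ a)) ⟩
  toℚ (a + (b ∸ a))         ≡⟨ cong toℚ (ℕP.m+[n∸m]≡n a≤b) ⟩
  toℚ b                     ∎
  where open ℚP.≤-Reasoning

≤toℚ-trans : ∀ {q a b} → q ℚ.≤ toℚ a → a ≤ b → q ℚ.≤ toℚ b
≤toℚ-trans q≤a a≤b = ℚP.≤-trans q≤a (toℚ-mono a≤b)

when : Bool → ℚ → ℚ
when c q = if c then q else 0ℚ

when-+ : ∀ c p q → when c (p ℚ.+ q) ≡ when c p ℚ.+ when c q
when-+ true  p q = refl
when-+ false p q = sym (ℚP.+-identityʳ 0ℚ)

0≤when : ∀ c {q} → 0ℚ ℚ.≤ q → 0ℚ ℚ.≤ when c q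
0≤when true  0≤q = 0≤q
0≤when false _   = ℚP.≤-refl

when-mono : ∀ c {p q} → p ℚ.≤ q → when c p ℚ.≤ when c q
when-mono true  p≤q = p≤q
when-mono false _   = ℚP.≤-refl

sumℚ-nonneg : ∀ {m} (q : Fin m → ℚ) → (∀ i → 0ℚ ℚ.≤ q i) → 0ℚ ℚ.≤ sumℚ q
sumℚ-nonneg {zero} q _ = ℚP.≤-refl
sumℚ-nonneg {suc m} q 0≤q =
  subst (ℚ._≤ sumℚ q) (ℚP.+-identityʳ 0ℚ)
        (ℚP.+-mono-≤ (0≤q zero) (sumℚ-nonneg (q ∘ suc) (0≤q ∘ suc)))

sumℚ-mono : ∀ {m} (p q : Fin m → ℚ) → (∀ i → p i ℚ.≤ q i) → sumℚ p ℚ.≤ sumℚ q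
sumℚ-mono {zero} _ _ _ = ℚP.≤-refl
sumℚ-mono {suc m} p q p≤q = ℚP.+-mono-≤ (p≤q zero) (sumℚ-mono (p ∘ suc) (q ∘ suc) (p≤q ∘ suc))

term≤sumℚ : ∀ {m} (q : Fin m → ℚ) → (∀ i → 0ℚ ℚ.≤ q i) → ∀ i → q i ℚ.≤ sumℚ q
term≤sumℚ {suc m} q 0≤q zero =
  subst (ℚ._≤ sumℚ q) (ℚP.+-identityʳ (q zero))
        (ℚP.+-monoʳ-≤ (q zero) (sumℚ-nonneg (q ∘ suc) (0≤q ∘ suc)))
term≤sumℚ {suc m} q 0≤q (suc i) =
  subst (ℚ._≤ sumℚ q) (ℚP.+-identityˡ (q (suc i)))
        (ℚP.+-mono-≤ (0≤q zero) (term≤sumℚ (q ∘ suc) (0≤q ∘ suc) i))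

sumℚ-when-1 : ∀ {m} (C : Fin m → Bool) → sumℚ (λ i → when (C i) 1ℚ) ≡ toℚ (count C)
sumℚ-when-1 {zero} C = refl
sumℚ-when-1 {suc m} C =
  trans (cong₂ ℚ._+_ (when-1 (C zero)) (sumℚ-when-1 (C ∘ suc))) (sym (toℚ-+ (indicator (C zero)) _))
  where
  when-1 : ∀ b → when b 1ℚ ≡ toℚ (indicator b)
  when-1 true  = refl
  when-1 false = refl

-- Certificates bound the other measures

module _ {m} {h : BoolFun m} {z : Input m} {C : Fin m → Bool} (cert : IsCertificate h z C) where

  flipSet-outside-certificate : ∀ B → (∀ i → C i ≡ true → B i ≡ false) → h (flipSet z B) ≡ h z
  flipSet-outside-certificate B B∩C≡∅ =
    cert (flipSet z B) (λ i Cᵢ → trans (cong (z i xor_) (B∩C≡∅ i Cᵢ)) (BoolP.xor-identityʳ (z i)))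

  certificate-meets-sensitive : ∀ {B} → Sensitive h z B → ∃ λ i → B i ≡ true × C i ≡ true
  certificate-meets-sensitive {B} sensitive with FinP.any? (λ i → (B i ∧ C i) Bool.≟ true)
  ... | yes (i , BᵢCᵢ) = i , ∧≡true⇒ BᵢCᵢ
  ... | no disjoint = ⊥-elim (sensitive (flipSet-outside-certificate B B∩C≡∅))
    where
    B∩C≡∅ : ∀ i → C i ≡ true → B i ≡ false
    B∩C≡∅ i Cᵢ with B i in Bᵢ
    ... | false = refl
    ... | true  = ⊥-elim (disjoint (i , trans (cong (_∧ C i) Bᵢ) Cᵢ))

  sens≤certificate : sens h z ≤ count C
  sens≤certificate = count-mono sensitive⇒∈C
    where
    sensitive⇒∈C : ∀ i → h (flip1 z i) xor h z ≡ true → C i ≡ true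
    sensitive⇒∈C i sensitive with C i in Cᵢ
    ... | true  = refl
    ... | false = ⊥-elim (xor≡true⇒≢ sensitive (cert (flip1 z i) agree))
      where
      agree : ∀ j → C j ≡ true → flip1 z i j ≡ z j
      agree j Cⱼ = flip1-other z (λ i≡j → true≢false (trans (sym Cⱼ) (trans (cong C (sym i≡j)) Cᵢ)))

  blocks≤certificate : ∀ {k} → DisjointSensitiveBlocks h z k → k ≤ count C
  blocks≤certificate {k} (B , sensitive , disjoint) =
    injection⇒≤count k C (proj₁ ∘ meet) (proj₂ ∘ proj₂ ∘ meet) meet-injective
    where
    meet : ∀ a → ∃ λ i → B a i ≡ true × C i ≡ true
    meet a = certificate-meets-sensitive (sensitive a)
    meet-injective : ∀ a b → proj₁ (meet a) ≡ proj₁ (meet b) → a ≡ b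
    meet-injective a b same with a ≟ b
    ... | yes a≡b = a≡b
    ... | no a≢b  = ⊥-elim (true≢false (begin
      true                     ≡⟨ sym (proj₁ (proj₂ (meet b))) ⟩
      B b (proj₁ (meet b))     ≡⟨ cong (B b) (sym same) ⟩
      B b (proj₁ (meet a))     ≡⟨ disjoint a b a≢b _ (proj₁ (proj₂ (meet a))) ⟩
      false                    ∎))
      where open ≡-Reasoning

  -- Weak LP duality: the indicator of C is a feasible fractional hitting set.
  module _ {b : (Fin m → Bool) → ℚ} (feasible : FeasibleFbs h z b) where

    private
      sensitive? : (Fin m → Bool) → Bool
      sensitive? B = h (flipSet z B) xor h z

      weightOn : Fin m → List (Fin m → Bool) → ℚ
      weightOn i = sumSens h z (λ B → B i) b

    weight≤weightOnCertificate : ∀ B →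
      when (sensitive? B ∧ true) (b B) ℚ.≤ sumℚ (λ i → when (C i) (when (sensitive? B ∧ B i) (b B)))
    weight≤weightOnCertificate B with sensitive? B in sensitive
    ... | false = sumℚ-nonneg _ (λ i → 0≤when (C i) ℚP.≤-refl)
    ... | true  = subst (ℚ._≤ _) atHit (term≤sumℚ _ nonneg i)
      where
      0≤b : 0ℚ ℚ.≤ b B
      0≤b = proj₁ (proj₁ feasible B (xor≡true⇒≢ sensitive))
      hit : ∃ λ i → B i ≡ true × C i ≡ true
      hit = certificate-meets-sensitive (xor≡true⇒≢ sensitive)
      i : Fin m
      i = proj₁ hit
      nonneg : ∀ j → 0ℚ ℚ.≤ when (C j) (when (B j) (b B))
      nonneg j = 0≤when (C j) (0≤when (B j) 0≤b)
      atHit : when (C i) (when (B i) (b B)) ≡ b B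
      atHit rewrite proj₁ (proj₂ hit) | proj₂ (proj₂ hit) = refl

    value≤weightOnCertificate : ∀ L →
      sumSens h z (λ _ → true) b L ℚ.≤ sumℚ (λ i → when (C i) (weightOn i L))
    value≤weightOnCertificate [] = sumℚ-nonneg _ (λ i → 0≤when (C i) ℚP.≤-refl)
    value≤weightOnCertificate (B ∷ L) = begin
      when (sensitive? B ∧ true) (b B) ℚ.+ sumSens h z (λ _ → true) b L
        ≤⟨ ℚP.+-mono-≤ (weight≤weightOnCertificate B) (value≤weightOnCertificate L) ⟩
      sumℚ head ℚ.+ sumℚ rest                    ≡⟨ sym (∑-distrib-+ head rest) ⟩
      sumℚ (λ i → head i ℚ.+ rest i)             ≡⟨ sum-cong-≗ (λ i → sym (when-+ (C i) _ _)) ⟩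
      sumℚ (λ i → when (C i) (weightOn i (B ∷ L))) ∎
      where
      open ℚP.≤-Reasoning
      head rest : Fin m → ℚ
      head i = when (C i) (when (sensitive? B ∧ B i) (b B))
      rest i = when (C i) (weightOn i L)

    fbsValue≤certificate : fbsValue h z b ℚ.≤ toℚ (count C)
    fbsValue≤certificate = begin
      fbsValue h z b                                  ≤⟨ value≤weightOnCertificate (allSubsets m) ⟩
      sumℚ (λ i → when (C i) (weightOn i (allSubsets m)))
        ≤⟨ sumℚ-mono _ _ (λ i → when-mono (C i) (proj₂ feasible i)) ⟩
      sumℚ (λ i → when (C i) 1ℚ)                      ≡⟨ sumℚ-when-1 C ⟩
      toℚ (count C)                                   ∎
      where open ℚP.≤-Reasoning

countWhere : ∀ {m} → ((Fin m → Bool) → Bool) → List (Fin m → Bool) → ℕ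
countWhere q [] = 0
countWhere q (B ∷ L) = indicator (q B) + countWhere q L

countWhere-++ : ∀ {m} (q : (Fin m → Bool) → Bool) L L′ →
                countWhere q (L ++ L′) ≡ countWhere q L + countWhere q L′
countWhere-++ q [] L′ = refl
countWhere-++ q (B ∷ L) L′ =
  trans (cong (indicator (q B) +_) (countWhere-++ q L L′)) (sym (ℕP.+-assoc (indicator (q B)) _ _))

countWhere-map : ∀ {m m′} (q : (Fin m → Bool) → Bool) (g : (Fin m′ → Bool) → (Fin m → Bool)) L →
                 countWhere q (map g L) ≡ countWhere (q ∘ g) L
countWhere-map q g [] = refl
countWhere-map q g (B ∷ L) = cong (indicator (q (g B)) +_) (countWhere-map q g L)

countWhere-cong : ∀ {m} {q q′ : (Fin m → Bool) → Bool} → q ≗ q′ →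
                  ∀ L → countWhere q L ≡ countWhere q′ L
countWhere-cong q≗q′ [] = refl
countWhere-cong q≗q′ (B ∷ L) = cong₂ _+_ (cong indicator (q≗q′ B)) (countWhere-cong q≗q′ L)

countWhere-none : ∀ {m} {q : (Fin m → Bool) → Bool} → (∀ B → q B ≡ false) → ∀ L → countWhere q L ≡ 0
countWhere-none q≡false [] = refl
countWhere-none q≡false (B ∷ L) rewrite q≡false B = countWhere-none q≡false L

IsSingleton : ∀ {m} → (Fin m → Bool) → Bool
IsSingleton B = count B ≡ᵇ 1

#empty : ∀ m → countWhere (λ B → count B ≡ᵇ 0) (allSubsets m) ≡ 1
#empty zero = refl
#empty (suc m) = trans (countWhere-++ _ (map _ (allSubsets m)) (map _ (allSubsets m)))
  (cong₂ _+_ (trans (countWhere-map _ _ (allSubsets m)) (#empty m))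
             (trans (countWhere-map _ _ (allSubsets m)) (countWhere-none (λ _ → refl) (allSubsets m))))

#singletons : ∀ m → countWhere IsSingleton (allSubsets m) ≡ m
#singletons zero = refl
#singletons (suc m) = trans (countWhere-++ _ (map _ (allSubsets m)) (map _ (allSubsets m)))
  (trans (cong₂ _+_ (trans (countWhere-map _ _ (allSubsets m)) (#singletons m))
                    (trans (countWhere-map _ _ (allSubsets m)) (#empty m)))
         (ℕP.+-comm m 1))

#singletons∋ : ∀ m (i : Fin m) → countWhere (λ B → IsSingleton B ∧ B i) (allSubsets m) ≡ 1
#singletons∋ (suc m) zero = trans (countWhere-++ _ (map _ (allSubsets m)) (map _ (allSubsets m)))
  (cong₂ _+_ (trans (countWhere-map _ _ (allSubsets m))
                    (countWhere-none (λ B → BoolP.∧-zeroʳ _) (allSubsets m)))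
             (trans (countWhere-map _ _ (allSubsets m))
                    (trans (countWhere-cong (λ B → BoolP.∧-identityʳ _) (allSubsets m)) (#empty m))))
#singletons∋ (suc m) (suc i) = trans (countWhere-++ _ (map _ (allSubsets m)) (map _ (allSubsets m)))
  (cong₂ _+_ (trans (countWhere-map _ _ (allSubsets m)) (#singletons∋ m i))
             (trans (countWhere-map _ _ (allSubsets m)) (countWhere-none empty∌i (allSubsets m))))
  where
  empty∌i : ∀ (B : Fin m → Bool) → (count B ≡ᵇ 0) ∧ B i ≡ false
  empty∌i B with count B in ∣B∣
  ... | zero  = count≡0⇒empty B ∣B∣ i
  ... | suc _ = refl

singleton⇒flip1 : ∀ {m} (B : Fin m → Bool) → count B ≡ 1 → ∃ λ a → B ≗ flip1 zeroVec a
singleton⇒flip1 {suc m} B ∣B∣≡1 with B zero in B₀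
... | true = zero , λ { zero → B₀ ; (suc j) → count≡0⇒empty (B ∘ suc) (ℕP.suc-injective ∣B∣≡1) j }
... | false with singleton⇒flip1 (B ∘ suc) ∣B∣≡1
... | a , B′≗a = suc a , λ { zero → B₀
                           ; (suc j) → trans (B′≗a j) (cong (if_then true else false) (sym (⌊suc≟suc⌋ a j))) }

-- Inputs are functions, so without function extensionality h need not respect ≗.
Extensional : ∀ {m} → BoolFun m → Set
Extensional {m} h = ∀ {x y : Input m} → x ≗ y → h x ≡ h y

FullySensitive : ∀ {m} → BoolFun m → Input m → Set
FullySensitive {m} h z = ∀ (i : Fin m) → h (flip1 z i) ≢ h z

flipSet-flip1 : ∀ {m} (z : Input m) i → flipSet z (flip1 zeroVec i) ≗ flip1 z i
flipSet-flip1 z i j with i ≟ j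
... | yes _ = trans (BoolP.xor-comm (z j) true) (BoolP.true-xor (z j))
... | no _  = BoolP.xor-identityʳ (z j)

module _ {m} {h : BoolFun m} {z : Input m} (ext : Extensional h) (full : FullySensitive h z) where

  full-certificate : IsCertificate h z (λ _ → true)
  full-certificate y agree = ext (λ i → agree i refl)

  sens-fullySensitive : sens h z ≡ m
  sens-fullySensitive = trans (count-cong (λ i → ≢⇒xor≡true (full i))) (count-full m)

  singleton-sensitive : ∀ a → Sensitive h z (flip1 zeroVec a)
  singleton-sensitive a = full a ∘ trans (ext (λ j → sym (flipSet-flip1 z a j)))

  singletonBlocks : DisjointSensitiveBlocks h z m
  singletonBlocks = flip1 zeroVec , singleton-sensitive , disjoint
    where
    disjoint : ∀ a b → a ≢ b → ∀ i → flip1 zeroVec a i ≡ true → flip1 zeroVec b i ≡ false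
    disjoint a b a≢b i aᵢ with a ≟ i
    ... | yes refl rewrite ≟-false {i = b} {a} (a≢b ∘ sym) = refl

  singletonWeight : (Fin m → Bool) → ℚ
  singletonWeight B = when (IsSingleton B) 1ℚ

  sumSens-singletonWeight : ∀ p L →
    sumSens h z p singletonWeight L ≡ toℚ (countWhere (λ B → IsSingleton B ∧ p B) L)
  sumSens-singletonWeight p [] = refl
  sumSens-singletonWeight p (B ∷ L) =
    trans (cong₂ ℚ._+_ (term-as-indicator (IsSingleton B) (p B) singleton⇒sensitive) (sumSens-singletonWeight p L))
          (sym (toℚ-+ (indicator (IsSingleton B ∧ p B)) _))
    where
    singleton⇒sensitive : IsSingleton B ≡ true → h (flipSet z B) xor h z ≡ true
    singleton⇒sensitive single with singleton⇒flip1 B (ℕP.≡ᵇ⇒≡ (count B) 1 (subst Bool.T (sym single) _))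
    ... | a , B≗a = ≢⇒xor≡true (singleton-sensitive a ∘ trans (ext (flipSet-cong B≗a)))
      where
      flipSet-cong : ∀ {B B′} → B ≗ B′ → flipSet z B′ ≗ flipSet z B
      flipSet-cong B≗B′ j = cong (z j xor_) (sym (B≗B′ j))
    term-as-indicator : ∀ s {t} q → (s ≡ true → t ≡ true) →
                        when (t ∧ q) (when s 1ℚ) ≡ toℚ (indicator (s ∧ q))
    term-as-indicator true  q s⇒t rewrite s⇒t refl with q
    ... | true  = refl
    ... | false = refl
    term-as-indicator false {t} q _ with t ∧ q
    ... | true  = refl
    ... | false = refl

  singletonWeight-feasible : FeasibleFbs h z singletonWeight
  singletonWeight-feasible = (λ B _ → bounds (IsSingleton B)) , perCoordinate
    where
    bounds : ∀ c → (0ℚ ℚ.≤ when c 1ℚ) × (when c 1ℚ ℚ.≤ 1ℚ)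
    bounds true  = 0≤toℚ 1 , ℚP.≤-refl
    bounds false = ℚP.≤-refl , 0≤toℚ 1
    perCoordinate : ∀ i → sumSens h z (λ B → B i) singletonWeight (allSubsets m) ℚ.≤ 1ℚ
    perCoordinate i = ℚP.≤-reflexive
      (trans (sumSens-singletonWeight (λ B → B i) (allSubsets m)) (cong toℚ (#singletons∋ m i)))

  singletonWeight-value : fbsValue h z singletonWeight ≡ toℚ m
  singletonWeight-value = begin
    fbsValue h z singletonWeight                                   ≡⟨ sumSens-singletonWeight _ (allSubsets m) ⟩
    toℚ (countWhere (λ B → IsSingleton B ∧ true) (allSubsets m))
      ≡⟨ cong toℚ (countWhere-cong (λ B → BoolP.∧-identityʳ _) (allSubsets m)) ⟩
    toℚ (countWhere IsSingleton (allSubsets m))                    ≡⟨ cong toℚ (#singletons m) ⟩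
    toℚ m                                                          ∎
    where open ≡-Reasoning

  fullySensitive⇒IsBs : IsBs h z m
  fullySensitive⇒IsBs =
    singletonBlocks , λ j blocks → subst (j ≤_) (count-full m) (blocks≤certificate full-certificate blocks)

  fullySensitive⇒IsFbs : IsFbs h z (toℚ m)
  fullySensitive⇒IsFbs =
    (singletonWeight , singletonWeight-feasible , singletonWeight-value) ,
    λ b feasible → subst (fbsValue h z b ℚ.≤_) (cong toℚ (count-full m))
                         (fbsValue≤certificate full-certificate feasible)

  fullySensitive⇒IsC : IsC h z m
  fullySensitive⇒IsC =
    ((λ _ → true) , full-certificate , count-full m) ,
    λ C cert → subst (_≤ count C) sens-fullySensitive (sens≤certificate cert)

-- Critical points

Critical : ∀ {n} → BoolFun n → Input n → Set
Critical {n} f y = ∀ (i : Fin n) → y i ≡ false → f (flip1 y i) ≢ f y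

critical? : ∀ {n} (f : BoolFun n) y → Dec (Critical f y)
critical? f y = FinP.all? (λ i → (y i Bool.≟ false) →-dec ¬? (f (flip1 y i) Bool.≟ f y))

Critical-cong : ∀ {n} {f : BoolFun n} → Extensional f →
                ∀ {y y′} → y ≗ y′ → Critical f y → Critical f y′
Critical-cong ext y≗y′ critical i y′ᵢ same =
  critical i (trans (y≗y′ i) y′ᵢ) (trans (ext (flip1-cong y≗y′ i)) (trans same (ext (sym ∘ y≗y′))))

ConstantOnInterval : ∀ {n} → BoolFun n → Input n → Input n → Set
ConstantOnInterval f x y = x ≼ y × (∀ w → x ≼ w → w ≼ y → f w ≡ f x)

ExtendsToCritical : ∀ {n} → BoolFun n → Set
ExtendsToCritical {n} f = ∀ (x : Input n) → ∃ λ y → ConstantOnInterval f x y × Critical f y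

module _ {n} {f : BoolFun n} (ext : Extensional f) where

  restrict-extensional : ∀ x → Extensional (restrict f x)
  restrict-extensional x y≗y′ = ext (embed-cong x y≗y′)

  critical⇒fullySensitive : ∀ {y} → Critical f y → FullySensitive (restrict f y) zeroVec
  critical⇒fullySensitive {y} critical j same =
    critical (zeroPos y j) (zeroPos-isZero y j)
      (trans (ext (sym ∘ embed-flip1 y j)) (trans same (ext (embed-zeroVec y))))

  interval⇒certificate : ∀ {x y} → ConstantOnInterval f x y →
                         IsCertificate (restrict f x) zeroVec (λ j → not (y (zeroPos x j)))
  interval⇒certificate {x} {y} (x≼y , constant) z agree =
    trans (constant (embed x z) (≼-embed x z) (embed-≼ x y z x≼y z≼y)) (sym (ext (embed-zeroVec x)))
    where
    z≼y : ∀ j → z j ≡ true → y (zeroPos x j) ≡ true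
    z≼y j zⱼ with y (zeroPos x j) in yⱼ
    ... | true  = refl
    ... | false = ⊥-elim (true≢false (trans (sym zⱼ) (agree j (cong not yⱼ))))

module _ {n} (f : BoolFun n) (Inv : Input n → Set)
         (step : ∀ {y} i → Inv y → y i ≡ false → f (flip1 y i) ≡ f y → Inv (flip1 y i)) where

  -- Greedily flip zeros that do not change f; d is fuel, as each flip raises count y.
  climb : ∀ d y → count y + d ≡ n → Inv y → ∃ λ y* → Inv y* × Critical f y*
  climb d y weight inv with FinP.any? (λ i → (y i Bool.≟ false) ×-dec (f (flip1 y i) Bool.≟ f y))
  ... | no stuck = y , inv , λ i yᵢ same → stuck (i , yᵢ , same)
  climb zero y weight inv | yes (i , yᵢ , _) =
    ⊥-elim (true≢false (trans (sym (count≡n⇒full y (trans (sym (ℕP.+-identityʳ _)) weight) i)) yᵢ))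
  climb (suc d) y weight inv | yes (i , yᵢ , same) = climb d (flip1 y i) weight′ (step i inv yᵢ same)
    where
    weight′ : count (flip1 y i) + d ≡ n
    weight′ = trans (cong (_+ d) (count-flip1 y i yᵢ)) (trans (sym (ℕP.+-suc (count y) d)) weight)

  climbToCritical : ∀ x → Inv x → ∃ λ y → Inv y × Critical f y
  climbToCritical x = climb (n ∸ count x) x (ℕP.m+[n∸m]≡n (count≤n x))

symmetric⇒extendsToCritical : ∀ {n} (f : BoolFun n) → Symmetric f → ExtendsToCritical f
symmetric⇒extendsToCritical {n} f symmetric x
  with climbToCritical f Inv step x (≼-refl , λ w lo hi → symmetric w x (ℕP.≤-antisym hi lo))
  where
  Inv : Input n → Set
  Inv y = x ≼ y × (∀ w → count x ≤ count w → count w ≤ count y → f w ≡ f x)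
  step : ∀ {y} i → Inv y → y i ≡ false → f (flip1 y i) ≡ f y → Inv (flip1 y i)
  step {y} i (x≼y , constant) yᵢ same = ≼-trans x≼y (≼-flip1 y i yᵢ) , constant′
    where
    constant′ : ∀ w → count x ≤ count w → count w ≤ count (flip1 y i) → f w ≡ f x
    constant′ w lo hi with count w ℕ.≤? count y
    ... | yes w≤y = constant w lo w≤y
    ... | no  w≰y = begin
      f w            ≡⟨ symmetric w (flip1 y i) (ℕP.≤-antisym hi flipped≤w) ⟩
      f (flip1 y i)  ≡⟨ same ⟩
      f y            ≡⟨ constant y (count-mono x≼y) ℕP.≤-refl ⟩
      f x            ∎
      where
      open ≡-Reasoning
      flipped≤w : count (flip1 y i) ≤ count w
      flipped≤w = subst (_≤ count w) (sym (count-flip1 y i yᵢ)) (ℕP.≰⇒> w≰y)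
... | y , (x≼y , constant) , critical =
  y , (x≼y , λ w x≼w w≼y → constant w (count-mono x≼w) (count-mono w≼y)) , critical

monotone⇒extendsToCritical : ∀ {n} (f : BoolFun n) → Monotone f → ExtendsToCritical f
monotone⇒extendsToCritical {n} f monotone x with climbToCritical f Inv step x (≼-refl , refl)
  where
  Inv : Input n → Set
  Inv y = x ≼ y × f y ≡ f x
  step : ∀ {y} i → Inv y → y i ≡ false → f (flip1 y i) ≡ f y → Inv (flip1 y i)
  step {y} i (x≼y , fy≡fx) yᵢ same = ≼-trans x≼y (≼-flip1 y i yᵢ) , trans same fy≡fx
... | y , (x≼y , fy≡fx) , critical = y , (x≼y , sandwich monotone) , critical
  where
  sandwich : Monotone f → ∀ w → x ≼ w → w ≼ y → f w ≡ f x
  sandwich (inj₁ up)   w x≼w w≼y = true-⇔⇒≡ (λ fw → trans (sym fy≡fx) (up w y w≼y fw)) (up x w x≼w)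
  sandwich (inj₂ down) w x≼w w≼y = true-⇔⇒≡ (down x w x≼w) (λ fw → down w y w≼y (trans fy≡fx fw))

symmetric⇒extensional : ∀ {n} {f : BoolFun n} → Symmetric f → Extensional f
symmetric⇒extensional symmetric {x} {y} x≗y = symmetric x y (count-cong x≗y)

monotone⇒extensional : ∀ {n} {f : BoolFun n} → Monotone f → Extensional f
monotone⇒extensional (inj₁ up)   {x} {y} x≗y =
  true-⇔⇒≡ (up x y (≗⇒≼ x≗y)) (up y x (≗⇒≼ (sym ∘ x≗y)))
monotone⇒extensional (inj₂ down) {x} {y} x≗y =
  true-⇔⇒≡ (down y x (≗⇒≼ (sym ∘ x≗y))) (down x y (≗⇒≼ x≗y))

-- The critical point with the most zeros

∈-allSubsets : ∀ n (x : Input n) → ∃ λ y → y ∈ allSubsets n × y ≗ x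
∈-allSubsets zero x = (λ ()) , here refl , λ ()
∈-allSubsets (suc n) x with ∈-allSubsets n (x ∘ suc) | x zero in x₀
... | y , y∈ , y≗x | false = _ , ∈-++⁺ˡ (∈-map⁺ _ y∈) , λ { zero → sym x₀ ; (suc i) → y≗x i }
... | y , y∈ , y≗x | true  =
  _ , ∈-++⁺ʳ (map _ (allSubsets n)) (∈-map⁺ _ y∈) , λ { zero → sym x₀ ; (suc i) → y≗x i }

module _ {n} {f : BoolFun n} (ext : Extensional f) (extends : ExtendsToCritical f) where

  private
    criticals : List (Input n)
    criticals = filter (critical? f) (allSubsets n)

  maxCritical : Input n
  maxCritical = argmax numZeros (proj₁ (extends zeroVec)) criticals

  maxCritical-critical : Critical f maxCritical
  maxCritical-critical =
    argmax-all numZeros (proj₂ (proj₂ (extends zeroVec))) (all-filter (critical? f) (allSubsets n))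

  critical≤maxCritical : ∀ y → Critical f y → numZeros y ≤ numZeros maxCritical
  critical≤maxCritical y critical with ∈-allSubsets n y
  ... | y′ , y′∈ , y′≗y = subst (_≤ numZeros maxCritical) (numZeros-cong y′≗y)
    (All.lookup (f[xs]≤f[argmax] {f = numZeros} _ criticals)
                (∈-filter⁺ (critical? f) y′∈ (Critical-cong ext (sym ∘ y′≗y) critical)))

  certificate≤maxCritical : ∀ x →
    ∃ λ C → IsCertificate (restrict f x) zeroVec C × count C ≤ numZeros maxCritical
  certificate≤maxCritical x with extends x
  ... | y , interval , critical =
    _ , interval⇒certificate ext interval ,
    subst (_≤ numZeros maxCritical) (sym (count-zeros-above x y (proj₁ interval))) (critical≤maxCritical y critical)

  private
    k : ℕ
    k = numZeros maxCritical

    fullySensitive-max : FullySensitive (restrict f maxCritical) zeroVec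
    fullySensitive-max = critical⇒fullySensitive ext maxCritical-critical

    extensional-max : Extensional (restrict f maxCritical)
    extensional-max = restrict-extensional ext maxCritical

    certificates-bound : ∀ x {j} → (∀ {C} → IsCertificate (restrict f x) zeroVec C → j ≤ count C) → j ≤ k
    certificates-bound x bound =
      ℕP.≤-trans (bound (proj₁ (proj₂ (certificate≤maxCritical x))))
                 (proj₂ (proj₂ (certificate≤maxCritical x)))

    certificates-boundℚ : ∀ x {q} →
      (∀ {C} → IsCertificate (restrict f x) zeroVec C → q ℚ.≤ toℚ (count C)) → q ℚ.≤ toℚ k
    certificates-boundℚ x bound =
      ≤toℚ-trans (bound (proj₁ (proj₂ (certificate≤maxCritical x))))
                 (proj₂ (proj₂ (certificate≤maxCritical x)))

  allMeasures≡maxCriticalZeros : IsMs f k × IsMbs f k × IsFmbs f (toℚ k) × IsMCC f k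
  allMeasures≡maxCriticalZeros =
    ((maxCritical , sens-fullySensitive extensional-max fullySensitive-max) ,
      λ { x j refl → certificates-bound x sens≤certificate }) ,
    ((maxCritical , fullySensitive⇒IsBs extensional-max fullySensitive-max) ,
      λ x j isBs → certificates-bound x (λ cert → blocks≤certificate cert (proj₁ isBs))) ,
    ((maxCritical , fullySensitive⇒IsFbs extensional-max fullySensitive-max) ,
      λ { x r ((b , feasible , refl) , _) →
            certificates-boundℚ x (λ cert → fbsValue≤certificate cert feasible) }) ,
    ((maxCritical , fullySensitive⇒IsC extensional-max fullySensitive-max) ,
      λ x j isC → certificates-bound x (proj₂ isC _))

theorem3 : ∀ {n} (f : BoolFun n) → Symmetric f ⊎ Monotone f →
    ∃ λ (k : ℕ) → IsMs f k × IsMbs f k × IsFmbs f (toℚ k) × IsMCC f k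
theorem3 f (inj₁ symmetric) =
  _ , allMeasures≡maxCriticalZeros (symmetric⇒extensional symmetric) (symmetric⇒extendsToCritical f symmetric)
theorem3 f (inj₂ monotone) =
  _ , allMeasures≡maxCriticalZeros (monotone⇒extensional monotone) (monotone⇒extendsToCritical f monotone)
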